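{- Let $\alpha$ be a composition and write $\mathcal{S}_\alpha=\sum_\beta d_{\alpha\beta}F_\beta$. Then for every composition $\gamma$ and every composition $\beta$, $$d_{\alpha\beta}\le d_{(\alpha\cdot\gamma)(\beta\cdot\gamma)}\quad\text{and}\quad d_{\alpha\beta}\le d_{(\gamma\cdot\alpha)(\gamma\cdot\beta)}.$$
   Context: $\cdot$ denotes concatenation of compositions. For $\beta\vDash n$, $\mathrm{set}(\beta)=\{\beta_1,\beta_1+\beta_2,\dots\}$ (partial sums excluding $n$) and $F_\beta=\sum x_{i_1}\cdots x_{i_n}$ over $i_1\le\cdots\le i_n$ with $i_j<i_{j+1}$ whenever $j\in\mathrm{set}(\beta)$. The composition diagram of $\alpha$ has $\alpha_i$ left-justified cells in row $i$ (top to bottom). Cover relation: $\beta\lessdot\gamma$ if $\gamma=(1)\cdot\beta$ (new top row of one cell) or $\gamma$ is obtained from $\beta$ by adding $1$ to the leftmost part of $\beta$ equal to $k$, for some $k$ (cell added at the right end of that row). A standard composition tableau (SCT) of shape $\alpha\vDash n$ comes from a chain $\emptyset=\alpha^{n+1}\lessdot\cdots\lessdot\alpha^1=\alpha$ by putting $i$ in the cell added from $\alpha^{i+1}$ to $\alpha^i$. Its descent set is the set of $i$ with $i+1$ in a column weakly right of that of $i$; $\mathrm{com}(T)$ is the composition with this set. $\mathcal{S}_\alpha=\sum_T F_{\mathrm{com}(T)}$ over SCT $T$ of shape $\alpha$, so $d_{\alpha\beta}$ is the number of SCT of shape $\alpha$ with $\mathrm{com}(T)=\beta$. -}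

module Defs where

open import Data.Nat using (ℕ; zero; suc; _≤ᵇ_; _≡ᵇ_; _<_)
open import Data.Bool using (Bool; true; false; if_then_else_; _∧_)
open import Data.List using (List; []; _∷_; _++_; length; concatMap; filterᵇ)
open import Data.Nat.ListAction using (sum)
open import Data.Bool.ListAction using (any)
open import Data.List.Relation.Unary.All using (All)
open import Data.Product using (_×_; _,_)

-- A composition is a list of positive naturals (parts listed top row first).
IsComposition : List ℕ → Set
IsComposition α = All (λ k → 0 < k) α

_·_ : List ℕ → List ℕ → List ℕ
α · γ = α ++ γ

eqL : List ℕ → List ℕ → Bool
eqL [] [] = true
eqL (x ∷ xs) (y ∷ ys) = (x ≡ᵇ y) ∧ eqL xs ys
eqL _ _ = false

-- All compositions covering β, together with the column of the added cell.
-- Option 1: γ = (1)·β, new cell in column 1.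
-- Option 2: add 1 to the leftmost part equal to k (for each value k occurring):
--   we range over positions whose value does not occur earlier in the list,
--   the new cell lands in column k+1.
growAt : List ℕ → List ℕ → List (List ℕ × ℕ)
growAt pre [] = []
growAt pre (k ∷ rest) =
  let others = Data.List.map (λ { (γ , c) → (k ∷ γ , c) }) (growAt (k ∷ pre) rest)
  in if any (λ j → j ≡ᵇ k) pre
     then others
     else (suc k ∷ rest , suc k) ∷ others

covers : List ℕ → List (List ℕ × ℕ)
covers β = ((1 ∷ β) , 1) ∷ growAt [] β

-- All saturated chains ∅ = α^{n+1} ⋖ ⋯ ⋖ α^1 of length n, recorded as
-- (final shape α^1 , [c_1 , … , c_n]) where c_i is the column of the cell
-- containing entry i (the cell added from α^{i+1} to α^i).
-- Since distinct covering moves give distinct compositions, chains are in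
-- bijection with these move sequences, i.e. with SCT.
chains : ℕ → List (List ℕ × List ℕ)
chains zero = ([] , []) ∷ []
chains (suc n) =
  concatMap (λ { (β , cs) → Data.List.map (λ { (γ , c) → (γ , c ∷ cs) }) (covers β) })
            (chains n)

-- com(T) from the column sequence c_1 … c_n: i is a descent iff c_i ≤ c_{i+1}
-- (i+1 weakly right of i); the composition has set = descent set.
comGo : ℕ → List ℕ → List ℕ
comGo run [] = []
comGo run (c ∷ []) = run ∷ []
comGo run (c ∷ c' ∷ r) =
  if c ≤ᵇ c' then run ∷ comGo 1 (c' ∷ r) else comGo (suc run) (c' ∷ r)

com : List ℕ → List ℕ
com cs = comGo 1 cs

d : List ℕ → List ℕ → ℕ
d α β = length (filterᵇ (λ { (s , cs) → eqL s α ∧ eqL (com cs) β }) (chains (sum α)))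

module Submission where

-- An SCT T of shape α with com(T) = β is a chain of covers; we place a filling of γ
-- below or above it. Below: first build the rows of γ with the largest entries, then
-- replay the chain of T on top of them, which is possible because a cover of β stays a
-- cover of β·γ (the leftmost part equal to k does not move). Above: replay T first and
-- then build γ on top with the smallest entries. In both cases γ is filled row by row,
-- each row from right to left, so inside γ the descents are exactly the row ends, and
-- the junction with T is a descent as well, since every chain starts in column 1 and
-- every row of γ ends there. Hence com(T) becomes β·γ, resp. γ·β, and since both
-- constructions embed the enumerated chains order-preservingly, counting gives the
-- inequalities.

open import Defs
open import Data.Bool using (Bool; true; false; T; _∧_)
open import Data.Bool.ListAction using (any)
open import Data.Bool.Properties using (T-∧)
open import Data.Empty using (⊥-elim)
open import Data.List
  using (List; []; _∷_; _++_; [_]; length; map; concatMap; filterᵇ; head; last)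
open import Data.List.Membership.Propositional using (_∈_; lose)
open import Data.List.Membership.Propositional.Properties using (∈-concatMap⁺)
open import Data.List.Properties using (++-identityʳ; map-++; map-∘; map-cong; concatMap-++)
open import Data.List.Relation.Binary.Sublist.Propositional
  using (_⊆_; []; _∷_; _∷ʳ_; ⊆-refl; ⊆-trans; minimum; from∈)
open import Data.List.Relation.Binary.Sublist.Propositional.Properties
  using (map⁺; ++⁺; ++⁺ˡ; filter⁺; length-mono-≤)
open import Data.List.Relation.Unary.All as All using (All; []; _∷_)
open import Data.List.Relation.Unary.All.Properties as All using ()
open import Data.List.Relation.Unary.Any using (here; there)
open import Data.Maybe using (just)
open import Data.Maybe.Relation.Unary.All as Maybe using (just; nothing)
open import Data.Nat
  using (ℕ; zero; suc; _+_; _≤_; _<_; _≤ᵇ_; _≡ᵇ_; _<ᵇ_; z≤n; s≤s)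
open import Data.Nat.ListAction using (sum)
open import Data.Nat.ListAction.Properties using (sum-++)
open import Data.Nat.Properties
  using (≤-trans; m≤n⇒m≤1+n; +-suc; +-comm; +-identityʳ; ≡ᵇ⇒≡; ≡⇒≡ᵇ)
open import Data.Product using (_×_; _,_; proj₁; proj₂)
open import Function using (_∘_; id; Equivalence)
open import Relation.Binary.PropositionalEquality
  using (_≡_; refl; sym; trans; cong; cong₂; subst; subst₂; module ≡-Reasoning)
open import Relation.Nullary.Decidable using (T?)

private
  variable
    A B C D : Set

length-filterᵇ-map : (p : A → Bool) (q : B → Bool) (f : A → B) {xs : List A} →
  All (λ x → T (p x) → T (q (f x))) xs →
  length (filterᵇ p xs) ≤ length (filterᵇ q (map f xs))
length-filterᵇ-map p q f [] = z≤n
length-filterᵇ-map p q f {x ∷ xs} (px⇒qfx ∷ rest) with p x | q (f x) | px⇒qfx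
... | true  | true  | _ = s≤s (length-filterᵇ-map p q f rest)
... | true  | false | h = ⊥-elim (h _)
... | false | true  | _ = m≤n⇒m≤1+n (length-filterᵇ-map p q f rest)
... | false | false | _ = length-filterᵇ-map p q f rest

length-filterᵇ-≤ : {p : A → Bool} {q : B → Bool} (f : A → B) {xs : List A} {ys : List B} →
  map f xs ⊆ ys → All (λ x → T (p x) → T (q (f x))) xs →
  length (filterᵇ p xs) ≤ length (filterᵇ q ys)
length-filterᵇ-≤ {p = p} {q} f f[xs]⊆ys pres =
  ≤-trans (length-filterᵇ-map p q f pres)
          (length-mono-≤ (filter⁺ (T? ∘ q) (T? ∘ q) (λ { refl → id }) f[xs]⊆ys))

map⁺-commuting : {f : A → B} {g : B → C} {h : A → D} {k : D → C} {xs : List A} {ys : List D} →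
  (∀ x → g (f x) ≡ k (h x)) → map h xs ⊆ ys → map g (map f xs) ⊆ map k ys
map⁺-commuting {f = f} {g} {h} {k} {xs} {ys} square h[xs]⊆ys =
  subst (_⊆ map k ys) (sym g∘f≡k∘h) (map⁺ k h[xs]⊆ys)
  where
  open ≡-Reasoning
  g∘f≡k∘h : map g (map f xs) ≡ map k (map h xs)
  g∘f≡k∘h = begin
    map g (map f xs) ≡⟨ map-∘ xs ⟨
    map (g ∘ f) xs   ≡⟨ map-cong square xs ⟩
    map (k ∘ h) xs   ≡⟨ map-∘ xs ⟩
    map k (map h xs) ∎

Chain : Set
Chain = List ℕ × List ℕ

attach : List ℕ → List ℕ × ℕ → Chain
attach cs (γ , c) = (γ , c ∷ cs)

step : Chain → List Chain
step (β , cs) = map (attach cs) (covers β)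

extend : List Chain → List Chain
extend = concatMap step

extendⁿ : ℕ → List Chain → List Chain
extendⁿ zero    L = L
extendⁿ (suc k) L = extend (extendⁿ k L)

chains-+ : ∀ k n → chains (k + n) ≡ extendⁿ k (chains n)
chains-+ zero    n = refl
chains-+ (suc k) n = cong extend (chains-+ k n)

extendⁿ-++ : ∀ k (L M : List Chain) → extendⁿ k (L ++ M) ≡ extendⁿ k L ++ extendⁿ k M
extendⁿ-++ zero    L M = refl
extendⁿ-++ (suc k) L M =
  trans (cong extend (extendⁿ-++ k L M)) (concatMap-++ step (extendⁿ k L) (extendⁿ k M))

extend-mono : {L M : List Chain} → L ⊆ M → extend L ⊆ extend M
extend-mono []           = []
extend-mono (x ∷ʳ L⊆M)   = ++⁺ˡ (step x) (extend-mono L⊆M)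
extend-mono (refl ∷ L⊆M) = ++⁺ ⊆-refl (extend-mono L⊆M)

∈-extend-newRow : ∀ {τ ds L} → (τ , ds) ∈ L → (1 ∷ τ , 1 ∷ ds) ∈ extend L
∈-extend-newRow x∈L = ∈-concatMap⁺ step (lose x∈L (here refl))

∈-extend-growTopRow : ∀ {k τ ds L} → (k ∷ τ , ds) ∈ L → (suc k ∷ τ , suc k ∷ ds) ∈ extend L
∈-extend-growTopRow x∈L = ∈-concatMap⁺ step (lose x∈L (there (here refl)))

rowColumns : ℕ → List ℕ
rowColumns zero    = []
rowColumns (suc k) = suc k ∷ rowColumns k

-- The column word of γ filled with the entries 1, 2, … row by row from the top,
-- each row from right to left, followed by the column word cs of the rest.
superstandard : List ℕ → List ℕ → List ℕ
superstandard []      cs = cs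
superstandard (k ∷ γ) cs = rowColumns k ++ superstandard γ cs

stackOnTop : List ℕ → Chain → Chain
stackOnTop γ (σ , cs) = (γ ++ σ , superstandard γ cs)

∈-extendⁿ-row : ∀ j {τ ds m L} → (τ , ds) ∈ extendⁿ m L →
  (suc j ∷ τ , rowColumns (suc j) ++ ds) ∈ extendⁿ (suc j + m) L
∈-extendⁿ-row zero    x∈L = ∈-extend-newRow x∈L
∈-extendⁿ-row (suc j) x∈L = ∈-extend-growTopRow (∈-extendⁿ-row j x∈L)

∈-extendⁿ-stackOnTop : ∀ {γ} → IsComposition γ → ∀ {x L} → x ∈ L →
  stackOnTop γ x ∈ extendⁿ (sum γ) L
∈-extendⁿ-stackOnTop []                 x∈L = x∈L
∈-extendⁿ-stackOnTop (s≤s z≤n ∷ γ-comp) x∈L =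
  ∈-extendⁿ-row _ (∈-extendⁿ-stackOnTop γ-comp x∈L)

stackOnTop-⊆-extendⁿ : ∀ {γ} → IsComposition γ → (L : List Chain) →
  map (stackOnTop γ) L ⊆ extendⁿ (sum γ) L
stackOnTop-⊆-extendⁿ γ-comp []      = minimum _
stackOnTop-⊆-extendⁿ {γ} γ-comp (x ∷ L) =
  subst (map (stackOnTop γ) (x ∷ L) ⊆_) (sym (extendⁿ-++ (sum γ) [ x ] L))
    (++⁺ (from∈ (∈-extendⁿ-stackOnTop γ-comp (here refl))) (stackOnTop-⊆-extendⁿ γ-comp L))

stackOnTop-⊆-chains : ∀ {γ} → IsComposition γ → ∀ n →
  map (stackOnTop γ) (chains n) ⊆ chains (sum γ + n)
stackOnTop-⊆-chains {γ} γ-comp n =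
  subst (map (stackOnTop γ) (chains n) ⊆_) (sym (chains-+ (sum γ) n))
        (stackOnTop-⊆-extendⁿ γ-comp (chains n))

appendShape : List ℕ → List ℕ × ℕ → List ℕ × ℕ
appendShape γ (β , c) = (β ++ γ , c)

consShape : ℕ → List ℕ × ℕ → List ℕ × ℕ
consShape k (β , c) = (k ∷ β , c)

-- A part of β equal to k is leftmost in β ++ γ iff it is leftmost in β.
growAt-++ : ∀ γ pre β → map (appendShape γ) (growAt pre β) ⊆ growAt pre (β ++ γ)
growAt-++ γ pre []      = minimum _
growAt-++ γ pre (k ∷ β) with any (λ j → j ≡ᵇ k) pre
... | true  = map⁺-commuting (λ _ → refl) (growAt-++ γ (k ∷ pre) β)
... | false = refl ∷ map⁺-commuting (λ _ → refl) (growAt-++ γ (k ∷ pre) β)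

covers-++ : ∀ γ β → map (appendShape γ) (covers β) ⊆ covers (β ++ γ)
covers-++ γ β = refl ∷ growAt-++ γ [] β

stackBelow : List ℕ → Chain → Chain
stackBelow γ (σ , cs) = (σ ++ γ , cs ++ superstandard γ [])

step-stackBelow : ∀ γ x → map (stackBelow γ) (step x) ⊆ step (stackBelow γ x)
step-stackBelow γ (β , cs) = map⁺-commuting (λ _ → refl) (covers-++ γ β)

extend-stackBelow : ∀ γ L → map (stackBelow γ) (extend L) ⊆ extend (map (stackBelow γ) L)
extend-stackBelow γ []      = []
extend-stackBelow γ (x ∷ L) =
  subst (_⊆ extend (map (stackBelow γ) (x ∷ L)))
        (sym (map-++ (stackBelow γ) (step x) (extend L)))
    (++⁺ (step-stackBelow γ x) (extend-stackBelow γ L))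

superstandard∈chains : ∀ {γ} → IsComposition γ → (γ , superstandard γ []) ∈ chains (sum γ)
superstandard∈chains {γ} γ-comp =
  subst₂ (λ σ n → (σ , superstandard γ []) ∈ chains n) (++-identityʳ γ) (+-identityʳ (sum γ))
    (subst ((γ ++ [] , superstandard γ []) ∈_) (sym (chains-+ (sum γ) 0))
           (∈-extendⁿ-stackOnTop γ-comp (here refl)))

stackBelow-⊆-chains : ∀ {γ} → IsComposition γ → ∀ n →
  map (stackBelow γ) (chains n) ⊆ chains (n + sum γ)
stackBelow-⊆-chains γ-comp zero    = from∈ (superstandard∈chains γ-comp)
stackBelow-⊆-chains {γ} γ-comp (suc n) =
  ⊆-trans (extend-stackBelow γ (chains n)) (extend-mono (stackBelow-⊆-chains γ-comp n))

comGo-++ : ∀ r c xs ys → Maybe.All (_≡ 1) (last (c ∷ xs)) → Maybe.All (0 <_) (head ys) →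
  comGo r (c ∷ xs ++ ys) ≡ comGo r (c ∷ xs) ++ com ys
comGo-++ r c []        []          _ _ = refl
comGo-++ r c []        (zero ∷ ys)  _ (just ())
comGo-++ r c []        (suc y ∷ ys) (just refl) _ = refl
comGo-++ r c (c′ ∷ xs) ys last≡1 head>0 with c ≤ᵇ c′
... | true  = cong (r ∷_) (comGo-++ 1 c′ xs ys last≡1 head>0)
... | false = comGo-++ (suc r) c′ xs ys last≡1 head>0

-- A cell in column 1 followed by a cell in a positive column is a descent.
com-++ : ∀ xs ys → Maybe.All (_≡ 1) (last xs) → Maybe.All (0 <_) (head ys) →
  com (xs ++ ys) ≡ com xs ++ com ys
com-++ []       ys _      _      = refl
com-++ (c ∷ xs) ys last≡1 head>0 = comGo-++ 1 c xs ys last≡1 head>0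

<ᵇ-irrefl : ∀ n → (n <ᵇ n) ≡ false
<ᵇ-irrefl zero    = refl
<ᵇ-irrefl (suc n) = <ᵇ-irrefl n

comGo-rowColumns : ∀ k r → comGo r (rowColumns (suc k)) ≡ [ k + r ]
comGo-rowColumns zero    r = refl
comGo-rowColumns (suc k) r rewrite <ᵇ-irrefl k =
  trans (comGo-rowColumns k (suc r)) (cong [_] (+-suc k r))

last-rowColumns : ∀ k → Maybe.All (_≡ 1) (last (rowColumns k))
last-rowColumns zero          = nothing
last-rowColumns (suc zero)    = just refl
last-rowColumns (suc (suc k)) = last-rowColumns (suc k)

head-superstandard : ∀ {γ} → IsComposition γ → ∀ {ys} → Maybe.All (0 <_) (head ys) →
  Maybe.All (0 <_) (head (superstandard γ ys))
head-superstandard []             head>0 = head>0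
head-superstandard (s≤s z≤n ∷ _) _      = just (s≤s z≤n)

com-superstandard : ∀ {γ} → IsComposition γ → ∀ {ys} → Maybe.All (0 <_) (head ys) →
  com (superstandard γ ys) ≡ γ ++ com ys
com-superstandard []                           head>0 = refl
com-superstandard {suc k ∷ γ} (s≤s z≤n ∷ γ-comp) {ys} head>0 = begin
  com (rowColumns (suc k) ++ superstandard γ ys)
    ≡⟨ com-++ (rowColumns (suc k)) _ (last-rowColumns (suc k))
              (head-superstandard γ-comp head>0) ⟩
  com (rowColumns (suc k)) ++ com (superstandard γ ys)
    ≡⟨ cong₂ _++_ (comGo-rowColumns k 1) (com-superstandard γ-comp head>0) ⟩
  [ k + 1 ] ++ γ ++ com ys
    ≡⟨ cong (λ n → n ∷ γ ++ com ys) (+-comm k 1) ⟩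
  suc k ∷ γ ++ com ys ∎
  where open ≡-Reasoning

-- The first cell added to the empty composition, which carries the largest
-- entry, lies in column 1.
WellFormed : Chain → Set
WellFormed (s , [])     = s ≡ []
WellFormed (s , c ∷ cs) = 0 < c × last (c ∷ cs) ≡ just 1

wellFormed-head : ∀ {s cs} → WellFormed (s , cs) → Maybe.All (0 <_) (head cs)
wellFormed-head {cs = []}    _         = nothing
wellFormed-head {cs = _ ∷ _} (c>0 , _) = just c>0

wellFormed-last : ∀ {s cs} → WellFormed (s , cs) → Maybe.All (_≡ 1) (last cs)
wellFormed-last {cs = []}    _            = nothing
wellFormed-last {cs = _ ∷ _} (_ , last≡1) =
  subst (Maybe.All (_≡ 1)) (sym last≡1) (just refl)

growAt-columns-positive : ∀ pre β → All ((0 <_) ∘ proj₂) (growAt pre β)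
growAt-columns-positive pre []      = []
growAt-columns-positive pre (k ∷ β) with any (λ j → j ≡ᵇ k) pre
... | true  = All.map⁺ (growAt-columns-positive (k ∷ pre) β)
... | false = s≤s z≤n ∷ All.map⁺ (growAt-columns-positive (k ∷ pre) β)

covers-columns-positive : ∀ β → All ((0 <_) ∘ proj₂) (covers β)
covers-columns-positive β = s≤s z≤n ∷ growAt-columns-positive [] β

step-wellFormed : ∀ {x} → WellFormed x → All WellFormed (step x)
step-wellFormed {[] , []}   refl         = (s≤s z≤n , refl) ∷ []
step-wellFormed {s , _ ∷ _} (_ , last≡1) =
  All.map⁺ (All.map (_, last≡1) (covers-columns-positive s))

chains-wellFormed : ∀ n → All WellFormed (chains n)
chains-wellFormed zero    = refl ∷ []
chains-wellFormed (suc n) =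
  All.concat⁺ (All.map⁺ (All.map step-wellFormed (chains-wellFormed n)))

isSCTᵇ : List ℕ → List ℕ → Chain → Bool
isSCTᵇ α β (s , cs) = eqL s α ∧ eqL (com cs) β

eqL-sound : ∀ xs ys → T (eqL xs ys) → xs ≡ ys
eqL-sound []       []       _ = refl
eqL-sound []       (_ ∷ _)  ()
eqL-sound (_ ∷ _)  []       ()
eqL-sound (x ∷ xs) (y ∷ ys) h with Equivalence.to T-∧ h
... | x≡ᵇy , xs≡ys = cong₂ _∷_ (≡ᵇ⇒≡ x y x≡ᵇy) (eqL-sound xs ys xs≡ys)

eqL-complete : ∀ {xs ys} → xs ≡ ys → T (eqL xs ys)
eqL-complete {[]}     refl = _
eqL-complete {x ∷ xs} refl =
  Equivalence.from T-∧ (≡⇒≡ᵇ x x refl , eqL-complete {xs} refl)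

isSCTᵇ-sound : ∀ α β s cs → T (isSCTᵇ α β (s , cs)) → s ≡ α × com cs ≡ β
isSCTᵇ-sound α β s cs h with Equivalence.to T-∧ h
... | s≡α , com≡β = eqL-sound s α s≡α , eqL-sound (com cs) β com≡β

isSCTᵇ-complete : ∀ {α β} x → proj₁ x ≡ α → com (proj₂ x) ≡ β → T (isSCTᵇ α β x)
isSCTᵇ-complete _ s≡α com≡β =
  Equivalence.from T-∧ (eqL-complete s≡α , eqL-complete com≡β)

d-≤ : ∀ {α β α′ β′} (f : Chain → Chain) → map f (chains (sum α)) ⊆ chains (sum α′) →
  (∀ {x} → WellFormed x → T (isSCTᵇ α β x) → T (isSCTᵇ α′ β′ (f x))) →
  d α β ≤ d α′ β′
d-≤ {α} f f[chains]⊆chains pres =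
  length-filterᵇ-≤ f f[chains]⊆chains (All.map pres (chains-wellFormed (sum α)))

com-stackBelow : ∀ {γ} → IsComposition γ → ∀ {s cs} → WellFormed (s , cs) →
  com (cs ++ superstandard γ []) ≡ com cs ++ γ
com-stackBelow {γ} γ-comp {cs = cs} wf = begin
  com (cs ++ superstandard γ [])
    ≡⟨ com-++ cs _ (wellFormed-last wf) (head-superstandard γ-comp nothing) ⟩
  com cs ++ com (superstandard γ [])
    ≡⟨ cong (com cs ++_) (com-superstandard γ-comp nothing) ⟩
  com cs ++ γ ++ []
    ≡⟨ cong (com cs ++_) (++-identityʳ γ) ⟩
  com cs ++ γ ∎
  where open ≡-Reasoning

isSCTᵇ-stackBelow : ∀ {γ} → IsComposition γ → ∀ {α β x} → WellFormed x →
  T (isSCTᵇ α β x) → T (isSCTᵇ (α · γ) (β · γ) (stackBelow γ x))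
isSCTᵇ-stackBelow {γ} γ-comp {α} {β} {s , cs} wf h =
  let s≡α , com≡β = isSCTᵇ-sound α β s cs h in
  isSCTᵇ-complete (stackBelow γ (s , cs)) (cong (_++ γ) s≡α)
    (trans (com-stackBelow γ-comp wf) (cong (_++ γ) com≡β))

isSCTᵇ-stackOnTop : ∀ {γ} → IsComposition γ → ∀ {α β x} → WellFormed x →
  T (isSCTᵇ α β x) → T (isSCTᵇ (γ · α) (γ · β) (stackOnTop γ x))
isSCTᵇ-stackOnTop {γ} γ-comp {α} {β} {s , cs} wf h =
  let s≡α , com≡β = isSCTᵇ-sound α β s cs h in
  isSCTᵇ-complete (stackOnTop γ (s , cs)) (cong (γ ++_) s≡α)
    (trans (com-superstandard γ-comp (wellFormed-head wf)) (cong (γ ++_) com≡β))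

-- Only γ needs positive parts.
lemma6p7 : (α β γ : List ℕ) → IsComposition α → IsComposition β → IsComposition γ →
    (d α β ≤ d (α · γ) (β · γ)) × (d α β ≤ d (γ · α) (γ · β))
lemma6p7 α β γ _ _ γ-comp =
  d-≤ {α} {β} (stackBelow γ) below (isSCTᵇ-stackBelow γ-comp) ,
  d-≤ {α} {β} (stackOnTop γ) onTop (isSCTᵇ-stackOnTop γ-comp)
  where
  below : map (stackBelow γ) (chains (sum α)) ⊆ chains (sum (α · γ))
  below = subst (λ n → map (stackBelow γ) (chains (sum α)) ⊆ chains n) (sym (sum-++ α γ))
                (stackBelow-⊆-chains γ-comp (sum α))
  onTop : map (stackOnTop γ) (chains (sum α)) ⊆ chains (sum (γ · α))
  onTop = subst (λ n → map (stackOnTop γ) (chains (sum α)) ⊆ chains n) (sym (sum-++ γ α))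
                (stackOnTop-⊆-chains γ-comp (sum α))
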